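{- For every static binary search tree $T$ on the keys $\{1,\ldots,n\}$ there is a set of positive weights $W^T = w^T_1, \ldots, w^T_n$ such that for all $i,j \in \{1,\ldots,n\}$, $$r(T,i,j) \le \lg \frac{\sum_{k=\min(i,j)}^{\max(i,j)} w^T_k}{\min(w^T_i, w^T_j)}.$$
   Context: $d_T(v)$ is the depth of node $v$ in $T$ (root has depth $0$), $\mathrm{LCA}_T(i,j)$ the lowest common ancestor of $i$ and $j$, and $r(T,i,j) = d_T(i)+d_T(j)-2d_T(\mathrm{LCA}_T(i,j))$. $\lg$ is the base-2 logarithm. -}

module Defs where

open import Data.Nat using (ℕ; zero; suc; _+_; _*_; _∸_; _^_; _≤_; _<_; _⊓_; _⊔_; _≟_)
open import Data.List using (List; []; _∷_; length; map; upTo)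
open import Data.Nat.ListAction using (sum)
open import Data.Maybe using (Maybe; just; nothing)
open import Data.Product using (_×_)
open import Relation.Nullary using (yes; no)
open import Function.Bundles using (_⇔_)

data Tree : Set where
  leaf : Tree
  node : Tree → ℕ → Tree → Tree

data _∈T_ (k : ℕ) : Tree → Set where
  here  : ∀ {l r} → k ∈T node l k r
  left  : ∀ {l x r} → k ∈T l → k ∈T node l x r
  right : ∀ {l x r} → k ∈T r → k ∈T node l x r

data AllT (P : ℕ → Set) : Tree → Set where
  leaf : AllT P leaf
  node : ∀ {l x r} → AllT P l → P x → AllT P r → AllT P (node l x r)

data IsBST : Tree → Set where
  leaf : IsBST leaf
  node : ∀ {l x r} → IsBST l → AllT (_< x) l → AllT (x <_) r → IsBST r →
         IsBST (node l x r)

BSTOn : ℕ → Tree → Set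
BSTOn n T = IsBST T × (∀ k → (k ∈T T) ⇔ (1 ≤ k × k ≤ n))

pathTo : Tree → ℕ → Maybe (List ℕ)
pathTo leaf v = nothing
pathTo (node l x r) v with x ≟ v
... | yes _ = just (x ∷ [])
... | no _ with pathTo l v
...   | just p = just (x ∷ p)
...   | nothing with pathTo r v
...     | just p = just (x ∷ p)
...     | nothing = nothing

path : Tree → ℕ → List ℕ
path T v with pathTo T v
... | just p = p
... | nothing = []

depth : Tree → ℕ → ℕ
depth T v = length (path T v) ∸ 1

commonPrefix : List ℕ → List ℕ → List ℕ
commonPrefix (x ∷ xs) (y ∷ ys) with x ≟ y
... | yes _ = x ∷ commonPrefix xs ys
... | no _ = []
commonPrefix _ _ = []

lastOr0 : List ℕ → ℕ
lastOr0 [] = 0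
lastOr0 (x ∷ []) = x
lastOr0 (x ∷ y ∷ ys) = lastOr0 (y ∷ ys)

LCA : Tree → ℕ → ℕ → ℕ
LCA T i j = lastOr0 (commonPrefix (path T i) (path T j))

rdist : Tree → ℕ → ℕ → ℕ
rdist T i j = depth T i + depth T j ∸ 2 * depth T (LCA T i j)

-- Σ_{k=a}^{b} w k   (empty-free: used only with a ≤ b)
sumRange : (ℕ → ℕ) → ℕ → ℕ → ℕ
sumRange w a b = sum (map (λ t → w (a + t)) (upTo (suc (b ∸ a))))

module Submission where

-- Give key k the weight 4^(h - d(k)), where h is the height of T. In a search
-- tree the lowest common ancestor a of i and j is a key between i and j, and it
-- is no deeper than either of them. So the range sum is at least
-- w(a) = 4^(d - d(a)) · 4^(h - d) with d = max(d(i), d(j)), and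
-- r(T,i,j) ≤ 2(d - d(a)) while 4^(h - d) = min(w(i), w(j)).

open import Defs
open import Data.Nat using (ℕ; suc; _+_; _∸_; _*_; _^_; _≤_; _<_; _⊓_; _⊔_; z≤n; s≤s; _≟_)
open import Data.Nat.Properties
open import Data.Nat.ListAction using (sum)
open import Data.List using (List; []; _∷_; length)
open import Data.List.Membership.Propositional using (_∈_)
open import Data.List.Membership.Propositional.Properties using (∈-map⁺; ∈-upTo⁺)
open import Data.List.Relation.Unary.Any as Any using ()
open import Data.Maybe using (just; nothing)
open import Data.Product using (Σ; ∃; _×_; _,_; proj₁; proj₂)
open import Data.Empty using (⊥-elim)
open import Relation.Nullary using (yes; no)
open import Relation.Binary.PropositionalEquality
open import Function.Bundles using (Equivalence)

private variable
  l r S T : Tree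
  i j v x y y′ : ℕ
  p q : List ℕ
  P Q : ℕ → Set

AllT-map : (∀ {k} → P k → Q k) → AllT P T → AllT Q T
AllT-map f leaf = leaf
AllT-map f (node al px ar) = node (AllT-map f al) (f px) (AllT-map f ar)

AllT-∈ : AllT P T → v ∈T T → P v
AllT-∈ (node _ px _) here = px
AllT-∈ (node al _ _) (left m) = AllT-∈ al m
AllT-∈ (node _ _ ar) (right m) = AllT-∈ ar m

rootKey : Tree → ℕ
rootKey leaf = 0
rootKey (node _ x _) = x

rootKey-∈ : v ∈T T → rootKey T ∈T T
rootKey-∈ here = here
rootKey-∈ (left _) = here
rootKey-∈ (right _) = here

height : Tree → ℕ
height leaf = 0
height (node l _ r) = suc (height l ⊔ height r)

path-of-just : ∀ T v → pathTo T v ≡ just p → path T v ≡ p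
path-of-just T v e with pathTo T v
path-of-just T v refl | just _ = refl

pathTo-absent : AllT (_≢ v) T → pathTo T v ≡ nothing
pathTo-absent leaf = refl
pathTo-absent {v} (node {x = x} al x≢v ar) with x ≟ v
... | yes x≡v = ⊥-elim (x≢v x≡v)
... | no _ rewrite pathTo-absent al | pathTo-absent ar = refl

pathTo-root : ∀ l x r → pathTo (node l x r) x ≡ just (x ∷ [])
pathTo-root l x r with x ≟ x
... | yes _ = refl
... | no x≢x = ⊥-elim (x≢x refl)

just-path : ∀ T v → pathTo T v ≡ just p → pathTo T v ≡ just (path T v)
just-path T v e = trans e (cong just (sym (path-of-just T v e)))

pathTo-∈ : IsBST T → v ∈T T → pathTo T v ≡ just (path T v)
pathTo-left : IsBST (node l x r) → v ∈T l → pathTo (node l x r) v ≡ just (x ∷ path l v)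
pathTo-right : IsBST (node l x r) → v ∈T r → pathTo (node l x r) v ≡ just (x ∷ path r v)

pathTo-∈ {node l x r} b here = just-path (node l x r) x (pathTo-root l x r)
pathTo-∈ {T} {v} b (left v∈l) = just-path T v (pathTo-left b v∈l)
pathTo-∈ {T} {v} b (right v∈r) = just-path T v (pathTo-right b v∈r)

pathTo-left {x = x} {v = v} (node bl l<x _ _) v∈l with x ≟ v
... | yes refl = ⊥-elim (<-irrefl refl (AllT-∈ l<x v∈l))
... | no _ rewrite pathTo-∈ bl v∈l = refl

pathTo-right {x = x} {v = v} (node _ l<x x<r br) v∈r with x ≟ v
... | yes refl = ⊥-elim (<-irrefl refl (AllT-∈ x<r v∈r))
... | no _ rewrite pathTo-absent (AllT-map (λ k<x → <⇒≢ (<-trans k<x (AllT-∈ x<r v∈r))) l<x)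
                 | pathTo-∈ br v∈r = refl

path-root : path (node l x r) x ≡ x ∷ []
path-root {l} {x} {r} = path-of-just (node l x r) x (pathTo-root l x r)

path-left : IsBST (node l x r) → v ∈T l → path (node l x r) v ≡ x ∷ path l v
path-left {l} {x} {r} {v} b v∈l = path-of-just (node l x r) v (pathTo-left b v∈l)

path-right : IsBST (node l x r) → v ∈T r → path (node l x r) v ≡ x ∷ path r v
path-right {l} {x} {r} {v} b v∈r = path-of-just (node l x r) v (pathTo-right b v∈r)

path-head : IsBST T → v ∈T T → ∃ λ q → path T v ≡ rootKey T ∷ q
path-head _ here = [] , path-root
path-head b (left v∈l) = _ , path-left b v∈l
path-head b (right v∈r) = _ , path-right b v∈r

depth-root : depth (node l x r) x ≡ 0
depth-root {l} {x} {r} = cong (λ p → length p ∸ 1) (path-root {l} {x} {r})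

depth-child : IsBST S → v ∈T S → path T v ≡ x ∷ path S v → depth T v ≡ suc (depth S v)
depth-child bS v∈S e with path-head bS v∈S
... | _ , e′ rewrite e | e′ = refl

depth-left : IsBST (node l x r) → v ∈T l → depth (node l x r) v ≡ suc (depth l v)
depth-left {l} {x} {r} b@(node bl _ _ _) v∈l = depth-child {T = node l x r} bl v∈l (path-left b v∈l)

depth-right : IsBST (node l x r) → v ∈T r → depth (node l x r) v ≡ suc (depth r v)
depth-right {l} {x} {r} b@(node _ _ _ br) v∈r = depth-child {T = node l x r} br v∈r (path-right b v∈r)

depth≤height : IsBST T → v ∈T T → depth T v ≤ height T
depth≤height {node l x r} _ here rewrite depth-root {l} {x} {r} = z≤n
depth≤height b@(node bl _ _ _) (left v∈l) rewrite depth-left b v∈l =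
  s≤s (≤-trans (depth≤height bl v∈l) (m≤m⊔n _ _))
depth≤height b@(node _ _ _ br) (right v∈r) rewrite depth-right b v∈r =
  s≤s (≤-trans (depth≤height br v∈r) (m≤n⊔m _ _))

commonPrefix-∷ : ∀ x p q → commonPrefix (x ∷ p) (x ∷ q) ≡ x ∷ commonPrefix p q
commonPrefix-∷ x _ _ with x ≟ x
... | yes _ = refl
... | no x≢x = ⊥-elim (x≢x refl)

commonPrefix-≢ : y ≢ y′ → commonPrefix (y ∷ p) (y′ ∷ q) ≡ []
commonPrefix-≢ {y} {y′} y≢y′ with y ≟ y′
... | yes y≡y′ = ⊥-elim (y≢y′ y≡y′)
... | no _ = refl

commonPrefix-[]ʳ : ∀ p → commonPrefix p [] ≡ []
commonPrefix-[]ʳ [] = refl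
commonPrefix-[]ʳ (_ ∷ _) = refl

LCA-root : path T i ≡ x ∷ p → path T j ≡ x ∷ q → commonPrefix p q ≡ [] → LCA T i j ≡ x
LCA-root {x = x} {p} {q = q} ei ej e rewrite ei | ej | commonPrefix-∷ x p q | e = refl

LCA-child : IsBST S → i ∈T S → j ∈T S →
            path T i ≡ x ∷ path S i → path T j ≡ x ∷ path S j → LCA T i j ≡ LCA S i j
LCA-child {S} {x = x} bS i∈S j∈S ei ej with path-head bS i∈S | path-head bS j∈S
... | p , ei′ | q , ej′ rewrite ei | ej | ei′ | ej′
  | commonPrefix-∷ x (rootKey S ∷ p) (rootKey S ∷ q) | commonPrefix-∷ (rootKey S) p q = refl

LCA-split : IsBST (node l x r) → i ∈T l → j ∈T r →
            LCA (node l x r) i j ≡ x × LCA (node l x r) j i ≡ x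
LCA-split {l} {x} {r} {i} {j} b@(node bl l<x x<r br) i∈l j∈r
  with path-head bl i∈l | path-head br j∈r
... | _ , ei | _ , ej =
  LCA-root {T = node l x r} {i = i} {j = j}
    (path-left b i∈l) (path-right b j∈r) (divergent ei ej l≢r) ,
  LCA-root {T = node l x r} {i = j} {j = i}
    (path-right b j∈r) (path-left b i∈l) (divergent ej ei (≢-sym l≢r))
  where
  l≢r = <⇒≢ (<-trans (AllT-∈ l<x (rootKey-∈ i∈l)) (AllT-∈ x<r (rootKey-∈ j∈r)))
  divergent : ∀ {s t} → s ≡ y ∷ p → t ≡ y′ ∷ q → y ≢ y′ → commonPrefix s t ≡ []
  divergent refl refl = commonPrefix-≢

record LCASpec (T : Tree) (i j a : ℕ) : Set where
  field
    a∈T : a ∈T T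
    ⊓≤a : i ⊓ j ≤ a
    a≤⊔ : a ≤ i ⊔ j
    depth≤ : depth T a ≤ depth T i

LCASpec-root : i ⊓ j ≤ x → x ≤ i ⊔ j → LCASpec (node l x r) i j x
LCASpec-root {i} {x = x} {l} {r} ⊓≤x x≤⊔ = record
  { a∈T = here ; ⊓≤a = ⊓≤x ; a≤⊔ = x≤⊔
  ; depth≤ = subst (_≤ depth (node l x r) i) (sym (depth-root {l} {x} {r})) z≤n }

LCASpec-child : ∀ {a} → (∀ {v} → v ∈T S → v ∈T T) →
                (∀ {v} → v ∈T S → depth T v ≡ suc (depth S v)) →
                i ∈T S → LCASpec S i j a → LCASpec T i j a
LCASpec-child embed depth-suc i∈S spec = record
  { a∈T = embed a∈T ; ⊓≤a = ⊓≤a ; a≤⊔ = a≤⊔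
  ; depth≤ = subst₂ _≤_ (sym (depth-suc a∈T)) (sym (depth-suc i∈S)) (s≤s depth≤) }
  where open LCASpec spec

LCA-spec : IsBST T → i ∈T T → j ∈T T → LCASpec T i j (LCA T i j)
LCA-spec {node l x r} {i} {j} b here j∈T with path-head b j∈T
... | _ , ej =
  subst (LCASpec _ i j)
    (sym (LCA-root {T = node l x r} {i = x} {j = j} (path-root {l} {x} {r}) ej refl))
    (LCASpec-root (m⊓n≤m _ _) (m≤m⊔n _ _))
LCA-spec {node l x r} {i} {j} b i∈T here with path-head b i∈T
... | p , ei =
  subst (LCASpec _ i j)
    (sym (LCA-root {T = node l x r} {i = i} {j = x} ei (path-root {l} {x} {r}) (commonPrefix-[]ʳ p)))
    (LCASpec-root (m⊓n≤n _ _) (m≤n⊔m _ _))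
LCA-spec {node l x r} {i} {j} b@(node bl _ _ _) (left i∈l) (left j∈l) =
  subst (LCASpec _ i j)
    (sym (LCA-child {T = node l x r} bl i∈l j∈l (path-left b i∈l) (path-left b j∈l)))
    (LCASpec-child left (depth-left b) i∈l (LCA-spec bl i∈l j∈l))
LCA-spec {node l x r} {i} {j} b@(node _ _ _ br) (right i∈r) (right j∈r) =
  subst (LCASpec _ i j)
    (sym (LCA-child {T = node l x r} br i∈r j∈r (path-right b i∈r) (path-right b j∈r)))
    (LCASpec-child right (depth-right b) i∈r (LCA-spec br i∈r j∈r))
LCA-spec {i = i} {j} b@(node _ l<x x<r _) (left i∈l) (right j∈r) =
  subst (LCASpec _ i j) (sym (proj₁ (LCA-split b i∈l j∈r))) (LCASpec-root
    (≤-trans (m⊓n≤m i j) (<⇒≤ (AllT-∈ l<x i∈l))) (≤-trans (<⇒≤ (AllT-∈ x<r j∈r)) (m≤n⊔m i j)))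
LCA-spec {i = i} {j} b@(node _ l<x x<r _) (right i∈r) (left j∈l) =
  subst (LCASpec _ i j) (sym (proj₂ (LCA-split b j∈l i∈r))) (LCASpec-root
    (≤-trans (m⊓n≤n i j) (<⇒≤ (AllT-∈ l<x j∈l))) (≤-trans (<⇒≤ (AllT-∈ x<r i∈r)) (m≤m⊔n i j)))

∈⇒≤sum : ∀ {k ks} → k ∈ ks → k ≤ sum ks
∈⇒≤sum (Any.here refl) = m≤m+n _ _
∈⇒≤sum (Any.there k∈ks) = ≤-trans (∈⇒≤sum k∈ks) (m≤n+m _ _)

sumRange-term : ∀ (w : ℕ → ℕ) {lo k hi} → lo ≤ k → k ≤ hi → w k ≤ sumRange w lo hi
sumRange-term w {lo} {k} {hi} lo≤k k≤hi = subst (λ t → w t ≤ sumRange w lo hi) (m+[n∸m]≡n lo≤k)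
  (∈⇒≤sum (∈-map⁺ (λ t → w (lo + t)) (∈-upTo⁺ (s≤s (∸-monoˡ-≤ lo k≤hi)))))

m+n∸2o≤2[m⊔n∸o] : ∀ m n o → m + n ∸ 2 * o ≤ 2 * ((m ⊔ n) ∸ o)
m+n∸2o≤2[m⊔n∸o] m n o = begin
  m + n ∸ 2 * o                   ≤⟨ ∸-monoˡ-≤ (2 * o) (+-mono-≤ (m≤m⊔n m n) (m≤n⊔m m n)) ⟩
  (m ⊔ n) + (m ⊔ n) ∸ 2 * o       ≡⟨ cong (λ t → (m ⊔ n) + t ∸ 2 * o) (+-identityʳ (m ⊔ n)) ⟨
  2 * (m ⊔ n) ∸ 2 * o             ≡⟨ *-distribˡ-∸ 2 (m ⊔ n) o ⟨
  2 * ((m ⊔ n) ∸ o)               ∎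
  where open ≤-Reasoning

m∸n+[o∸m]≡o∸n : ∀ {m n o} → n ≤ m → m ≤ o → (m ∸ n) + (o ∸ m) ≡ o ∸ n
m∸n+[o∸m]≡o∸n {m} {n} {o} n≤m m≤o = begin
  (m ∸ n) + (o ∸ m)   ≡⟨ +-comm (m ∸ n) (o ∸ m) ⟩
  (o ∸ m) + (m ∸ n)   ≡⟨ +-∸-assoc (o ∸ m) n≤m ⟨
  (o ∸ m) + m ∸ n     ≡⟨ cong (_∸ n) (m∸n+n≡m m≤o) ⟩
  o ∸ n               ∎
  where open ≡-Reasoning

weight : ℕ → ℕ → ℕ
weight h d = 2 ^ (2 * (h ∸ d))

weight-antitone : ∀ h {d d′} → d ≤ d′ → weight h d′ ≤ weight h d
weight-antitone h d≤d′ = ^-monoʳ-≤ 2 (*-monoʳ-≤ 2 (∸-monoʳ-≤ h d≤d′))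

weight-⊔ : ∀ h d d′ → weight h (d ⊔ d′) ≡ weight h d ⊓ weight h d′
weight-⊔ h = antimono-≤-distrib-⊔ (weight-antitone h)

2^r*weight≤weight : ∀ {r h d a} → r ≤ 2 * (d ∸ a) → a ≤ d → d ≤ h →
                    2 ^ r * weight h d ≤ weight h a
2^r*weight≤weight {r} {h} {d} {a} r≤ a≤d d≤h = begin
  2 ^ r * 2 ^ (2 * (h ∸ d))             ≡⟨ ^-distribˡ-+-* 2 r (2 * (h ∸ d)) ⟨
  2 ^ (r + 2 * (h ∸ d))                 ≤⟨ ^-monoʳ-≤ 2 (+-monoˡ-≤ (2 * (h ∸ d)) r≤) ⟩
  2 ^ (2 * (d ∸ a) + 2 * (h ∸ d))       ≡⟨ cong (2 ^_) (*-distribˡ-+ 2 (d ∸ a) (h ∸ d)) ⟨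
  2 ^ (2 * ((d ∸ a) + (h ∸ d)))         ≡⟨ cong (λ t → 2 ^ (2 * t)) (m∸n+[o∸m]≡o∸n a≤d d≤h) ⟩
  2 ^ (2 * (h ∸ a))                     ∎
  where open ≤-Reasoning

lemma1 : (n : ℕ) (T : Tree) → BSTOn n T →
    Σ (ℕ → ℕ) (λ w →
      ((k : ℕ) → 1 ≤ k → k ≤ n → 0 < w k) ×
      ((i j : ℕ) → 1 ≤ i → i ≤ n → 1 ≤ j → j ≤ n →
        2 ^ rdist T i j * (w i ⊓ w j) ≤ sumRange w (i ⊓ j) (i ⊔ j)))
lemma1 n T (bst , keys) = w , (λ k _ _ → m^n>0 2 (2 * (height T ∸ depth T k))) , range-bound
  where
  w : ℕ → ℕ
  w k = weight (height T) (depth T k)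
  range-bound : (i j : ℕ) → 1 ≤ i → i ≤ n → 1 ≤ j → j ≤ n →
                2 ^ rdist T i j * (w i ⊓ w j) ≤ sumRange w (i ⊓ j) (i ⊔ j)
  range-bound i j 1≤i i≤n 1≤j j≤n = begin
    2 ^ rdist T i j * (w i ⊓ w j)      ≡⟨ cong (2 ^ rdist T i j *_) (weight-⊔ (height T) dᵢ dⱼ) ⟨
    2 ^ rdist T i j * weight (height T) (dᵢ ⊔ dⱼ)
      ≤⟨ 2^r*weight≤weight (m+n∸2o≤2[m⊔n∸o] dᵢ dⱼ (depth T (LCA T i j)))
                           (≤-trans depth≤ (m≤m⊔n dᵢ dⱼ))
                           (⊔-lub (depth≤height bst i∈T) (depth≤height bst j∈T)) ⟩
    w (LCA T i j)                      ≤⟨ sumRange-term w ⊓≤a a≤⊔ ⟩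
    sumRange w (i ⊓ j) (i ⊔ j)         ∎
    where
    i∈T = Equivalence.from (keys i) (1≤i , i≤n)
    j∈T = Equivalence.from (keys j) (1≤j , j≤n)
    dᵢ = depth T i
    dⱼ = depth T j
    open LCASpec (LCA-spec bst i∈T j∈T)
    open ≤-Reasoning
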